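{- Suppose there exists a $3$-functor $\mathbf{Toff}\to\mathbf{Move}$ which is strict on every generating $3$-cell of $\mathbf{Toff}$. Then every chain of non-identity $3$-cells in $\mathbf{Toff}$ terminates. That is, there is no infinite sequence of $2$-cells $f_0,f_1,\ldots$ of $\mathbf{Toff}$ with a non-identity $3$-cell from $f_i$ to $f_{i+1}$ for every $i$.
   Context: A $3$-functor between strict $3$-categories sends $i$-cells to $i$-cells and preserves sources, targets, identities and all compositions $\star_j$. $\mathbf{Toff}$ is the free strict $3$-category generated as follows. - It has one $0$-cell $\ast$. - It has one generating $1$-cell, the wire $\ast\to\ast$; $n$ denotes a bundle of $n$ wires. - Its generating $2$-cells are $\mathtt{SWAP}:2\Rightarrow2$, $\mathtt{NOT}:1\Rightarrow1$, $\mathtt{T}_2:2\Rightarrow2$ and $\mathtt{T}_3:3\Rightarrow3$. Here $\star_0$ is parallel composition and $\star_1$ is sequential composition in diagrammatic order; $\mathrm{id}_n$ is the identity $2$-cell on $n$. Let - $P_3=(\mathtt{SWAP}\star_0\mathrm{id}_1)\star_1(\mathrm{id}_1\star_0\mathtt{SWAP})$; - $Q_3=(\mathrm{id}_1\star_0\mathtt{SWAP})\star_1(\mathtt{SWAP}\star_0\mathrm{id}_1)$; - $P_4=(\mathtt{SWAP}\star_0\mathrm{id}_2)\star_1(\mathrm{id}_1\star_0\mathtt{SWAP}\star_0\mathrm{id}_1)\star_1(\mathrm{id}_2\star_0\mathtt{SWAP})$; - $Q_4=(\mathrm{id}_2\star_0\mathtt{SWAP})\star_1(\mathrm{id}_1\star_0\mathtt{SWAP}\star_0\mathrm{id}_1)\star_1(\mathtt{SWAP}\star_0\mathrm{id}_2)$.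 The generating $3$-cells, written source $\Rrightarrow$ target, are: - $\mathtt{SWAP}\star_1\mathtt{SWAP}\Rrightarrow\mathrm{id}_2$; - $(\mathtt{SWAP}\star_0\mathrm{id}_1)\star_1(\mathrm{id}_1\star_0\mathtt{SWAP})\star_1(\mathtt{SWAP}\star_0\mathrm{id}_1)\Rrightarrow(\mathrm{id}_1\star_0\mathtt{SWAP})\star_1(\mathtt{SWAP}\star_0\mathrm{id}_1)\star_1(\mathrm{id}_1\star_0\mathtt{SWAP})$; - $\mathtt{NOT}\star_1\mathtt{NOT}\Rrightarrow\mathrm{id}_1$; - $\mathtt{T}_2\star_1\mathtt{T}_2\Rrightarrow\mathrm{id}_2$; - $\mathtt{T}_3\star_1\mathtt{T}_3\Rrightarrow\mathrm{id}_3$; - $\mathtt{SWAP}\star_1(\mathtt{NOT}\star_0\mathrm{id}_1)\Rrightarrow(\mathrm{id}_1\star_0\mathtt{NOT})\star_1\mathtt{SWAP}$; - $\mathtt{SWAP}\star_1(\mathrm{id}_1\star_0\mathtt{NOT})\Rrightarrow(\mathtt{NOT}\star_0\mathrm{id}_1)\star_1\mathtt{SWAP}$; - $P_3\star_1(\mathtt{T}_2\star_0\mathrm{id}_1)\Rrightarrow(\mathrm{id}_1\star_0\mathtt{T}_2)\star_1P_3$; - $Q_3\star_1(\mathrm{id}_1\star_0\mathtt{T}_2)\Rrightarrow(\mathtt{T}_2\star_0\mathrm{id}_1)\star_1Q_3$; - $P_4\star_1(\mathtt{T}_3\star_0\mathrm{id}_1)\Rrightarrow(\mathrm{id}_1\star_0\mathtt{T}_3)\star_1P_4$;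 - $Q_4\star_1(\mathrm{id}_1\star_0\mathtt{T}_3)\Rrightarrow(\mathtt{T}_3\star_0\mathrm{id}_1)\star_1Q_4$; - $(\mathtt{SWAP}\star_0\mathrm{id}_1)\star_1\mathtt{T}_3\Rrightarrow\mathtt{T}_3\star_1(\mathtt{SWAP}\star_0\mathrm{id}_1)$. $\mathbf{Move}$ is built from the following data. - ${\tt M}$ is the free monoid on $\{{\tt l},{\tt r},{\tt t}\}$. It is ordered by length, with words of equal length ordered lexicographically using ${\tt t}<{\tt r}<{\tt l}$. - ${\tt M}^n$ carries the product order; strict means componentwise $\le$ and not equal. The cells of $\mathbf{Move}$ are: - one $0$-cell $\ast$; - $1$-cells ${\tt M}^n$, with ${\tt M}^n\star_0{\tt M}^m={\tt M}^{n+m}$; - $2$-cells: maps ${\tt M}^n\to{\tt M}^n$ strictly increasing for the product order, with $\star_0$ the cartesian product and $f\star_1g=g\circ f$; - $3$-cells: pairs $\langle f,g\rangle$ of parallel $2$-cells with $f=g$ or $g(\vec x)<f(\vec x)$ for all $\vec x$. The $3$-cell $\langle f,g\rangle$ has source $f$ and target $g$. Its compositions are $\langle f,g\rangle\star_0\langle f',g'\rangle=\langle f\times f',g\times g'\rangle$, $\langle f,g\rangle\star_1\langle f',g'\rangle=\langle f'\circ f,g'\circ g\rangle$ and $\langle f,g\rangle\star_2\langle g,h\rangle=\langle f,h\rangle$. Its identities are the pairs $\langle f,f\rangle$. A $3$-functor $\varphi:\mathbf{Toff}\to\mathbf{Move}$ is strict on a $3$-cell $\alpha$ if: $\alpha$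 is an identity $3$-cell of $\mathbf{Toff}$ if and only if $\varphi(\alpha)$ is an identity $3$-cell of $\mathbf{Move}$. -}

module Defs where

open import Data.Nat using (ℕ; zero; suc; _+_; _<_)
open import Data.Nat.Properties using (+-assoc; +-identityʳ)
open import Data.List using (List; []; _∷_; length)
open import Data.Vec using (Vec; _++_)
open import Data.Vec.Relation.Binary.Pointwise.Inductive using (Pointwise)
open import Data.Product using (Σ; _×_; _,_)
open import Data.Sum using (_⊎_)
open import Relation.Nullary using (¬_)
open import Relation.Binary.PropositionalEquality using (_≡_; subst)
open import Relation.Binary.Construct.Closure.ReflexiveTransitive using (Star)
open import Relation.Binary.Construct.Closure.Transitive using (TransClosure)

data Letter : Set where
  𝕥 𝕣 𝕝 : Letter

data _<ₗ_ : Letter → Letter → Set where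
  t<r : 𝕥 <ₗ 𝕣
  t<l : 𝕥 <ₗ 𝕝
  r<l : 𝕣 <ₗ 𝕝

M : Set
M = List Letter

-- strict lexicographic order (used on words of equal length)
data _<lex_ : M → M → Set where
  here  : ∀ {a b u v} → a <ₗ b → (a ∷ u) <lex (b ∷ v)
  there : ∀ {a u v} → u <lex v → (a ∷ u) <lex (a ∷ v)

_<M_ : M → M → Set
u <M v = length u < length v ⊎ (length u ≡ length v × u <lex v)

_≤M_ : M → M → Set
u ≤M v = u <M v ⊎ u ≡ v

-- A 1-cell M^(n·k) of Move, seen as (M^k)^n (k = image of one wire).
Pt : ℕ → ℕ → Set
Pt k n = Vec (Vec M k) n

_≤ₚ_ : ∀ {k n} → Pt k n → Pt k n → Set
x ≤ₚ y = Pointwise (Pointwise _≤M_) x y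

_<ₚ_ : ∀ {k n} → Pt k n → Pt k n → Set
x <ₚ y = x ≤ₚ y × ¬ (x ≡ y)

-- 2-cells of Move are strictly increasing maps
StrictlyIncreasing : ∀ {k n} → (Pt k n → Pt k n) → Set
StrictlyIncreasing f = ∀ x y → x <ₚ y → f x <ₚ f y

Move3 : ∀ {k n} → (Pt k n → Pt k n) → (Pt k n → Pt k n) → Set
Move3 f g = (∀ x → f x ≡ g x) ⊎ (∀ x → g x <ₚ f x)

IsIdMove3 : ∀ {k n} → (Pt k n → Pt k n) → (Pt k n → Pt k n) → Set
IsIdMove3 f g = ∀ x → f x ≡ g x

data Gen : ℕ → Set where
  SWAP : Gen 2
  NOT  : Gen 1
  T₂   : Gen 2
  T₃   : Gen 3

-- 2-cell terms n ⇒ n (all generators are endomorphic; 1-cells are ℕ)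
infixr 7 _⋆₀_
infixr 6 _⋆₁_
data Tm : ℕ → Set where
  gen  : ∀ {n} → Gen n → Tm n
  id   : (n : ℕ) → Tm n
  _⋆₀_ : ∀ {m n} → Tm m → Tm n → Tm (m + n)
  _⋆₁_ : ∀ {n} → Tm n → Tm n → Tm n     -- diagrammatic order

infix 4 _≈_
data _≈_ : ∀ {n} → Tm n → Tm n → Set where
  ≈-refl  : ∀ {n} {f : Tm n} → f ≈ f
  ≈-sym   : ∀ {n} {f g : Tm n} → f ≈ g → g ≈ f
  ≈-trans : ∀ {n} {f g h : Tm n} → f ≈ g → g ≈ h → f ≈ h
  ⋆₀-cong : ∀ {m n} {f f' : Tm m} {g g' : Tm n} → f ≈ f' → g ≈ g' → f ⋆₀ g ≈ f' ⋆₀ g'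
  ⋆₁-cong : ∀ {n} {f f' g g' : Tm n} → f ≈ f' → g ≈ g' → f ⋆₁ g ≈ f' ⋆₁ g'
  ⋆₁-assoc  : ∀ {n} {f g h : Tm n} → (f ⋆₁ g) ⋆₁ h ≈ f ⋆₁ (g ⋆₁ h)
  ⋆₁-unitˡ  : ∀ {n} {f : Tm n} → id n ⋆₁ f ≈ f
  ⋆₁-unitʳ  : ∀ {n} {f : Tm n} → f ⋆₁ id n ≈ f
  ⋆₀-assoc  : ∀ {a b c} {f : Tm a} {g : Tm b} {h : Tm c} →
              subst Tm (+-assoc a b c) ((f ⋆₀ g) ⋆₀ h) ≈ f ⋆₀ (g ⋆₀ h)
  ⋆₀-unitˡ  : ∀ {n} {f : Tm n} → id 0 ⋆₀ f ≈ f
  ⋆₀-unitʳ  : ∀ {n} {f : Tm n} → subst Tm (+-identityʳ n) (f ⋆₀ id 0) ≈ f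
  id-⋆₀     : ∀ {m n} → id m ⋆₀ id n ≈ id (m + n)
  interchange : ∀ {m n} {f g : Tm m} {f' g' : Tm n} →
                (f ⋆₁ g) ⋆₀ (f' ⋆₁ g') ≈ (f ⋆₀ f') ⋆₁ (g ⋆₀ g')

𝐒 𝐍 𝐓₂ 𝐓₃ : Tm _
𝐒  = gen SWAP
𝐍  = gen NOT
𝐓₂ = gen T₂
𝐓₃ = gen T₃

P₃ Q₃ : Tm 3
P₃ = (𝐒 ⋆₀ id 1) ⋆₁ (id 1 ⋆₀ 𝐒)
Q₃ = (id 1 ⋆₀ 𝐒) ⋆₁ (𝐒 ⋆₀ id 1)

P₄ Q₄ : Tm 4
P₄ = (𝐒 ⋆₀ id 2) ⋆₁ (id 1 ⋆₀ 𝐒 ⋆₀ id 1) ⋆₁ (id 2 ⋆₀ 𝐒)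
Q₄ = (id 2 ⋆₀ 𝐒) ⋆₁ (id 1 ⋆₀ 𝐒 ⋆₀ id 1) ⋆₁ (𝐒 ⋆₀ id 2)

data Rule : ∀ {n} → Tm n → Tm n → Set where
  swap-swap : Rule (𝐒 ⋆₁ 𝐒) (id 2)
  yang-baxter : Rule ((𝐒 ⋆₀ id 1) ⋆₁ (id 1 ⋆₀ 𝐒) ⋆₁ (𝐒 ⋆₀ id 1))
                     ((id 1 ⋆₀ 𝐒) ⋆₁ (𝐒 ⋆₀ id 1) ⋆₁ (id 1 ⋆₀ 𝐒))
  not-not : Rule (𝐍 ⋆₁ 𝐍) (id 1)
  t₂-t₂   : Rule (𝐓₂ ⋆₁ 𝐓₂) (id 2)
  t₃-t₃   : Rule (𝐓₃ ⋆₁ 𝐓₃) (id 3)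
  swap-notˡ : Rule (𝐒 ⋆₁ (𝐍 ⋆₀ id 1)) ((id 1 ⋆₀ 𝐍) ⋆₁ 𝐒)
  swap-notʳ : Rule (𝐒 ⋆₁ (id 1 ⋆₀ 𝐍)) ((𝐍 ⋆₀ id 1) ⋆₁ 𝐒)
  P₃-t₂ : Rule (P₃ ⋆₁ (𝐓₂ ⋆₀ id 1)) ((id 1 ⋆₀ 𝐓₂) ⋆₁ P₃)
  Q₃-t₂ : Rule (Q₃ ⋆₁ (id 1 ⋆₀ 𝐓₂)) ((𝐓₂ ⋆₀ id 1) ⋆₁ Q₃)
  P₄-t₃ : Rule (P₄ ⋆₁ (𝐓₃ ⋆₀ id 1)) ((id 1 ⋆₀ 𝐓₃) ⋆₁ P₄)
  Q₄-t₃ : Rule (Q₄ ⋆₁ (id 1 ⋆₀ 𝐓₃)) ((𝐓₃ ⋆₀ id 1) ⋆₁ Q₄)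
  swap-t₃ : Rule ((𝐒 ⋆₀ id 1) ⋆₁ 𝐓₃) (𝐓₃ ⋆₁ (𝐒 ⋆₀ id 1))

infix 4 _⟶_
data _⟶_ : ∀ {n} → Tm n → Tm n → Set where
  step : ∀ {m a b} {s t : Tm m} {f g : Tm (a + (m + b))} →
         Rule s t → (u v : Tm (a + (m + b))) →
         f ≈ u ⋆₁ (id a ⋆₀ s ⋆₀ id b) ⋆₁ v →
         g ≈ u ⋆₁ (id a ⋆₀ t ⋆₀ id b) ⋆₁ v →
         f ⟶ g

-- 3-cells of Toff from f to g: rewriting paths (the free 3-category's 3-cells
-- are such paths modulo exchange; the empty path is the identity).
Cell3 : ∀ {n} → Tm n → Tm n → Set
Cell3 = Star _⟶_

-- existence of a NON-identity 3-cell f ⇛ g: a nonempty rewriting path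
NonId3 : ∀ {n} → Tm n → Tm n → Set
NonId3 = TransClosure _⟶_

record Functor3 : Set where
  field
    -- the wire is sent to M^k, hence the bundle n to M^(n·k) = (M^k)^n
    k       : ℕ
    F₂      : ∀ {n} → Tm n → Pt k n → Pt k n
    F₂-incr : ∀ {n} (f : Tm n) → StrictlyIncreasing (F₂ f)
    F₂-resp : ∀ {n} {f g : Tm n} → f ≈ g → ∀ x → F₂ f x ≡ F₂ g x
    F₂-id   : ∀ n x → F₂ (id n) x ≡ x
    F₂-⋆₁   : ∀ {n} (f g : Tm n) x → F₂ (f ⋆₁ g) x ≡ F₂ g (F₂ f x)
    F₂-⋆₀   : ∀ {m n} (f : Tm m) (g : Tm n) (x : Pt k m) (y : Pt k n) →
              F₂ (f ⋆₀ g) (x ++ y) ≡ F₂ f x ++ F₂ g y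
    F₃      : ∀ {n} {f g : Tm n} → Cell3 f g → Move3 (F₂ f) (F₂ g)

-- strict on every generating 3-cell: generating 3-cells are non-identity in
-- Toff, so their images must be non-identity 3-cells of Move
StrictOnGenerators : Functor3 → Set
StrictOnGenerators F = ∀ {n} {s t : Tm n} → Rule s t → ¬ IsIdMove3 (F₂ s) (F₂ t)
  where open Functor3 F

{-# OPTIONS --safe #-}
module Submission where

open import Defs
open import Data.Nat using (ℕ; suc)
open import Data.Product using (Σ)
open import Relation.Nullary using (¬_)

open import Level using (Level)
open import Function using (_∘_)
open import Data.Nat using (_+_; _*_; _^_; _≤_; _<_; NonZero; z≤n; s≤s)
open import Data.Nat.Properties
open import Data.Nat.Induction using (<-wellFounded)
open import Data.List using ([]; _∷_; length)
open import Data.Vec using (_∷_; _++_; map; sum; replicate)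
open import Data.Vec.Properties using (++-injectiveˡ; ++-injectiveʳ)
open import Data.Vec.Relation.Binary.Pointwise.Inductive using (Pointwise; []; _∷_)
open import Data.Product using (_,_)
open import Data.Sum using (_⊎_; inj₁; inj₂)
open import Data.Empty using (⊥-elim)
open import Relation.Nullary using (contradiction)
open import Relation.Binary.Core using (Rel)
open import Induction.WellFounded using (WellFounded)
open import Relation.Binary.PropositionalEquality
open import Relation.Binary.Construct.Closure.ReflexiveTransitive using (ε; _◅_)
open import Relation.Binary.Construct.Closure.Transitive using ([_]; _∷_)
open import Induction.InfiniteDescent
  using (InfiniteDescendingSequence; InfiniteDescendingSequenceFrom; Descent; descent∧wf⇒empty)

-- The image of a whiskered generating 3-cell
-- id a ⋆₀ s ⋆₀ id b ⇛ id a ⋆₀ t ⋆₀ id b is a 3-cell of Move which cannot be an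
-- identity (restricting it to the middle block would make F s = F t), so it is a
-- pointwise strict decrease; pre- and post-composing with the images of the
-- surrounding 2-cells, the latter strictly increasing, keeps it strict. Hence
-- every non-identity 3-cell f ⇛ g gives F g x < F f x at every point x. Reading
-- a word over t < r < l as a base-4 numeral with digits 1, 2, 3 is strictly
-- monotone for the length-lexicographic order, and summing over coordinates
-- turns the product order into the order of ℕ, so evaluating at a fixed point
-- maps any chain of non-identity 3-cells to a descending sequence in ℕ.

private
  variable
    a ℓ : Level
    A : Set a

wf⇒¬infiniteDescendingSequence : {A : Set a} {_≺_ : Rel A ℓ} {f : ℕ → A} →
  WellFounded _≺_ → ¬ InfiniteDescendingSequence _≺_ f
wf⇒¬infiniteDescendingSequence {A = A} {_≺_ = _≺_} {f} wf descending =
  descent∧wf⇒empty descent wf (f 0) (f , refl , descending)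
  where
  descent : Descent _≺_ (λ x → Σ (ℕ → A) λ g → InfiniteDescendingSequenceFrom _≺_ g x)
  descent (g , refl , g-descending) =
    g 1 , g-descending 0 , g ∘ suc , refl , g-descending ∘ suc

Ranking : (A → ℕ) → Rel A ℓ → Set _
Ranking μ R = ∀ {x y} → R x y → μ x < μ y ⊎ x ≡ y

ranked⇒≤ : (μ : A → ℕ) {x y : A} → μ x < μ y ⊎ x ≡ y → μ x ≤ μ y
ranked⇒≤ μ (inj₁ μx<μy) = <⇒≤ μx<μy
ranked⇒≤ μ (inj₂ refl)  = ≤-refl

sum-ranking : {μ : A → ℕ} {R : Rel A ℓ} {n : ℕ} →
  Ranking μ R → Ranking (sum ∘ map μ) (Pointwise R {n} {n})
sum-ranking ranking [] = inj₂ refl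
sum-ranking {μ = μ} ranking {x ∷ xs} (x∼y ∷ xs∼ys)
  with ranking x∼y | sum-ranking ranking xs∼ys
... | inj₁ μx<μy | tail = inj₁ (+-mono-<-≤ μx<μy (ranked⇒≤ (sum ∘ map μ) tail))
... | inj₂ refl  | inj₁ tail< = inj₁ (+-monoʳ-< (μ x) tail<)
... | inj₂ refl  | inj₂ refl  = inj₂ refl

digit : Letter → ℕ
digit 𝕥 = 1
digit 𝕣 = 2
digit 𝕝 = 3

instance
  digit-nonZero : ∀ {a} → NonZero (digit a)
  digit-nonZero {𝕥} = _
  digit-nonZero {𝕣} = _
  digit-nonZero {𝕝} = _

digit<4 : ∀ a → digit a < 4
digit<4 𝕥 = s≤s (s≤s z≤n)
digit<4 𝕣 = s≤s (s≤s (s≤s z≤n))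
digit<4 𝕝 = ≤-refl

digit-mono : ∀ {a b} → a <ₗ b → digit a < digit b
digit-mono t<r = ≤-refl
digit-mono t<l = s≤s (s≤s z≤n)
digit-mono r<l = ≤-refl

value : M → ℕ
value []      = 0
value (a ∷ u) = digit a * 4 ^ length u + value u

value<4^length : ∀ u → value u < 4 ^ length u
value<next-digit : ∀ a u → value (a ∷ u) < suc (digit a) * 4 ^ length u

value<4^length []      = s≤s z≤n
value<4^length (a ∷ u) = <-≤-trans (value<next-digit a u) (*-monoˡ-≤ _ (digit<4 a))

value<next-digit a u = begin-strict
  digit a * 4 ^ length u + value u        <⟨ +-monoʳ-< _ (value<4^length u) ⟩
  digit a * 4 ^ length u + 4 ^ length u   ≡⟨ +-comm _ (4 ^ length u) ⟩
  suc (digit a) * 4 ^ length u            ∎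
  where open ≤-Reasoning

value-mono-length : ∀ {u v} → length u < length v → value u < value v
value-mono-length {u} {b ∷ v} (s≤s |u|≤|v|) = begin-strict
  value u                 <⟨ value<4^length u ⟩
  4 ^ length u            ≤⟨ ^-monoʳ-≤ 4 |u|≤|v| ⟩
  4 ^ length v            ≤⟨ m≤n*m _ (digit b) ⟩
  digit b * 4 ^ length v  ≤⟨ m≤m+n _ _ ⟩
  value (b ∷ v)           ∎
  where open ≤-Reasoning

value-mono-lex : ∀ {u v} → length u ≡ length v → u <lex v → value u < value v
value-mono-lex {a ∷ u} {b ∷ v} |u|≡|v| (here a<b) = begin-strict
  value (a ∷ u)                 <⟨ value<next-digit a u ⟩
  suc (digit a) * 4 ^ length u  ≤⟨ *-monoˡ-≤ _ (digit-mono a<b) ⟩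
  digit b * 4 ^ length u        ≡⟨ cong (λ n → digit b * 4 ^ n) (suc-injective |u|≡|v|) ⟩
  digit b * 4 ^ length v        ≤⟨ m≤m+n _ _ ⟩
  value (b ∷ v)                 ∎
  where open ≤-Reasoning
value-mono-lex {a ∷ u} {.a ∷ v} |u|≡|v| (there u<v) =
  +-mono-≤-< (≤-reflexive (cong (λ n → digit a * 4 ^ n) (suc-injective |u|≡|v|)))
             (value-mono-lex (suc-injective |u|≡|v|) u<v)

value-ranking : Ranking value _≤M_
value-ranking {u} {v} (inj₁ (inj₁ |u|<|v|))         = inj₁ (value-mono-length {u} {v} |u|<|v|)
value-ranking {u} {v} (inj₁ (inj₂ (|u|≡|v| , u<v))) = inj₁ (value-mono-lex |u|≡|v| u<v)
value-ranking         (inj₂ u≡v)                    = inj₂ u≡v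

rank : ∀ {k n} → Pt k n → ℕ
rank = sum ∘ map (sum ∘ map value)

rank-mono : ∀ {k n} {x y : Pt k n} → x <ₚ y → rank x < rank y
rank-mono (x≤y , x≢y) with sum-ranking (sum-ranking value-ranking) x≤y
... | inj₁ rank< = rank<
... | inj₂ x≡y   = contradiction x≡y x≢y

whiskered-step : ∀ {m a b} {s t : Tm m} → Rule s t →
  id a ⋆₀ s ⋆₀ id b ⟶ id a ⋆₀ t ⋆₀ id b
whiskered-step r = step r (id _) (id _) unitors unitors
  where
  unitors : ∀ {n} {f : Tm n} → f ≈ id n ⋆₁ f ⋆₁ id n
  unitors = ≈-sym (≈-trans ⋆₁-unitˡ ⋆₁-unitʳ)

module _ (F : Functor3) where
  open Functor3 F

  origin : ∀ {n} → Pt k n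
  origin = replicate _ (replicate _ [])

  weight : ∀ {n} → Tm n → ℕ
  weight f = rank (F₂ f origin)

  F₂-whiskered : ∀ {a m b} (s : Tm m) (x : Pt k a) (y : Pt k m) (z : Pt k b) →
    F₂ (id a ⋆₀ s ⋆₀ id b) (x ++ y ++ z) ≡ x ++ F₂ s y ++ z
  F₂-whiskered {a} {m} {b} s x y z = begin
    F₂ (id a ⋆₀ s ⋆₀ id b) (x ++ y ++ z)   ≡⟨ F₂-⋆₀ (id a) (s ⋆₀ id b) x (y ++ z) ⟩
    F₂ (id a) x ++ F₂ (s ⋆₀ id b) (y ++ z) ≡⟨ cong₂ _++_ (F₂-id a x) (F₂-⋆₀ s (id b) y z) ⟩
    x ++ F₂ s y ++ F₂ (id b) z             ≡⟨ cong (λ w → x ++ F₂ s y ++ w) (F₂-id b z) ⟩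
    x ++ F₂ s y ++ z                       ∎
    where open ≡-Reasoning

  IsIdMove3-unwhisker : ∀ {a m b} {s t : Tm m} →
    IsIdMove3 (F₂ (id a ⋆₀ s ⋆₀ id b)) (F₂ (id a ⋆₀ t ⋆₀ id b)) → IsIdMove3 (F₂ s) (F₂ t)
  IsIdMove3-unwhisker {a} {m} {b} {s} {t} same y =
    ++-injectiveˡ _ _ (++-injectiveʳ o₁ o₁ (begin
      o₁ ++ F₂ s y ++ o₂                   ≡⟨ F₂-whiskered s o₁ y o₂ ⟨
      F₂ (id a ⋆₀ s ⋆₀ id b) (o₁ ++ y ++ o₂) ≡⟨ same _ ⟩
      F₂ (id a ⋆₀ t ⋆₀ id b) (o₁ ++ y ++ o₂) ≡⟨ F₂-whiskered t o₁ y o₂ ⟩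
      o₁ ++ F₂ t y ++ o₂                   ∎))
    where
    open ≡-Reasoning
    o₁ : Pt k a
    o₁ = origin
    o₂ : Pt k b
    o₂ = origin

  F₂-in-context : ∀ {n} {f u w v : Tm n} → f ≈ u ⋆₁ w ⋆₁ v →
    ∀ x → F₂ f x ≡ F₂ v (F₂ w (F₂ u x))
  F₂-in-context {u = u} {w} {v} f≈ x =
    trans (F₂-resp f≈ x) (trans (F₂-⋆₁ u (w ⋆₁ v) x) (F₂-⋆₁ w v (F₂ u x)))

  module _ (strict : StrictOnGenerators F) where

    whiskered-rule-decreasing : ∀ {m a b} {s t : Tm m} → Rule s t →
      ∀ y → F₂ (id a ⋆₀ t ⋆₀ id b) y <ₚ F₂ (id a ⋆₀ s ⋆₀ id b) y
    whiskered-rule-decreasing r with F₃ (whiskered-step r ◅ ε)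
    ... | inj₁ same       = ⊥-elim (strict r (IsIdMove3-unwhisker same))
    ... | inj₂ decreasing = decreasing

    step-decreasing : ∀ {n} {f g : Tm n} → f ⟶ g → ∀ x → F₂ g x <ₚ F₂ f x
    step-decreasing (step r u v f≈ g≈) x =
      subst₂ _<ₚ_ (sym (F₂-in-context g≈ x)) (sym (F₂-in-context f≈ x))
        (F₂-incr v _ _ (whiskered-rule-decreasing r (F₂ u x)))

    weight-decreasing : ∀ {n} {f g : Tm n} → NonId3 f g → weight g < weight f
    weight-decreasing [ f⟶g ] = rank-mono (step-decreasing f⟶g origin)
    weight-decreasing (f⟶g ∷ g⟶⁺h) =
      <-trans (weight-decreasing g⟶⁺h) (rank-mono (step-decreasing f⟶g origin))

lemma2 : (F : Functor3) → StrictOnGenerators F →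
         (n : ℕ) → ¬ (Σ (ℕ → Tm n) (λ f → (i : ℕ) → NonId3 (f i) (f (suc i))))
lemma2 F strict n (f , chain) =
  wf⇒¬infiniteDescendingSequence {f = weight F ∘ f} <-wellFounded
    (λ i → weight-decreasing F strict (chain i))
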